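{- Let $m\ge 0$ be an integer and $k=4m+3$. Let $n\ge 0$ and let $x=\sum_{i=0}^n x_i2^i$, $y=\sum_{i=0}^n y_i2^i$, $z=\sum_{i=0}^n z_i2^i$ with $x_i,y_i,z_i\in\{0,1\}$, and let $f(x,z)=\lfloor\frac{x+z}{k}\rfloor$. For $t=0,1,\dots,n$ define $S_t=\sum_{i=n-t}^{n}(x_i+z_i-ky_i)2^i$. Let $t\in\{0,\dots,n\}$ and suppose that $x_i\oplus y_i\oplus z_i=0$ for $i=0,1,\dots,n-t$ and that $y\le f(x,z)$. Then $S_t\ge 0$.
   Context: $\oplus$ denotes nim-sum (XOR); for bits this is addition modulo 2. -}

module Defs where

open import Data.Bool using (Bool; true; false)
open import Data.Nat using (ℕ; zero; suc; _+_; _*_; _∸_; _^_)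
open import Data.Integer as ℤ using (ℤ; +_)
open import Data.List using (List; upTo; map; foldr)

bit : Bool → ℕ
bit false = 0
bit true  = 1

val : ℕ → (ℕ → Bool) → ℕ
val zero    x = bit (x 0)
val (suc n) x = val n x + bit (x (suc n)) * 2 ^ suc n

-- integer sum  Σ_{i=lo}^{hi} g i  (empty if hi < lo)
sumRangeℤ : ℕ → ℕ → (ℕ → ℤ) → ℤ
sumRangeℤ lo hi g = foldr ℤ._+_ (+ 0) (map (λ j → g (lo + j)) (upTo (suc hi ∸ lo)))

S : (k n t : ℕ) → (x y z : ℕ → Bool) → ℤ
S k n t x y z =
  sumRangeℤ (n ∸ t) n (λ i → ((+ bit (x i)) ℤ.+ (+ bit (z i)) ℤ.- (+ k) ℤ.* (+ bit (y i))) ℤ.* (+ (2 ^ i)))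

{-# OPTIONS --safe #-}
-- Let L = n ∸ t. The number x + z − k y = Σ_{i≤n} (x_i + z_i − k y_i) 2^i is ≥ 0 because
-- y ≤ ⌊(x + z)/k⌋, and S_t is its part with i ≥ L. Every digit x_i + z_i − k y_i is at most 2,
-- so the part with i < L is < 2^(L+1). As k is odd and x_L ⊕ y_L ⊕ z_L = 0, the digit at L is
-- even, so 2^(L+1) divides S_t; a multiple of 2^(L+1) that becomes ≥ 0 when something below
-- 2^(L+1) is added is itself ≥ 0.
module Submission where

open import Defs
open import Data.Bool using (Bool; true; false; _xor_)
open import Data.Nat using (ℕ; zero; suc; _+_; _*_; _∸_; _≤_; _^_; NonZero; z≤n; s≤s)
import Data.Nat.Properties as ℕP
import Data.Nat.Divisibility as ℕ
open import Data.Nat.DivMod using (_/_; m/n*n≤m)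
open import Data.Integer using (+_) renaming (_≤_ to _≤ℤ_)
open import Data.Integer as ℤ using (ℤ; 0ℤ; +≤+; +<+)
import Data.Integer.Properties as ℤP
open import Data.Integer.Divisibility.Signed
  using (_∣_; divides; ∣ᵤ⇒∣; ∣m∣n⇒∣m+n; ∣m∣n⇒∣m-n; ∣m⇒∣m*n; ∣n⇒∣m*n; *-monoˡ-∣)
open import Data.Integer.Tactic.RingSolver using (solve-∀)
open import Data.List using (map; foldr; applyUpTo)
open import Data.Sum using (inj₁; inj₂)
open import Function using (_∘_)
open import Relation.Binary.PropositionalEquality
  using (_≡_; refl; sym; trans; cong; cong₂; subst; module ≡-Reasoning)

∑ : ℕ → (ℕ → ℤ) → ℤ
∑ zero    f = 0ℤ
∑ (suc c) f = f 0 ℤ.+ ∑ c (f ∘ suc)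

foldr-+-map-applyUpTo : ∀ (h : ℕ → ℤ) (g : ℕ → ℕ) c →
  foldr ℤ._+_ 0ℤ (map h (applyUpTo g c)) ≡ ∑ c (h ∘ g)
foldr-+-map-applyUpTo h g zero    = refl
foldr-+-map-applyUpTo h g (suc c) = cong (ℤ._+_ (h (g 0))) (foldr-+-map-applyUpTo h (g ∘ suc) c)

sumRangeℤ≡∑ : ∀ lo hi g → sumRangeℤ lo hi g ≡ ∑ (suc hi ∸ lo) (λ j → g (lo + j))
sumRangeℤ≡∑ lo hi g = foldr-+-map-applyUpTo (λ j → g (lo + j)) (λ j → j) (suc hi ∸ lo)

∑-+ : ∀ a b f → ∑ (a + b) f ≡ ∑ a f ℤ.+ ∑ b (λ j → f (a + j))
∑-+ zero    b f = sym (ℤP.+-identityˡ (∑ b f))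
∑-+ (suc a) b f = trans (cong (ℤ._+_ (f 0)) (∑-+ a b (f ∘ suc))) (sym (ℤP.+-assoc (f 0) _ _))

∑-suc : ∀ c f → ∑ (suc c) f ≡ ∑ c f ℤ.+ f c
∑-suc zero    f = ℤP.+-comm (f 0) 0ℤ
∑-suc (suc c) f = trans (cong (ℤ._+_ (f 0)) (∑-suc c (f ∘ suc))) (sym (ℤP.+-assoc (f 0) _ _))

∑-∣ : ∀ {d} c f → (∀ i → d ∣ f i) → d ∣ ∑ c f
∑-∣ {d} zero    f d∣f = divides 0ℤ (sym (ℤP.*-zeroˡ d))
∑-∣     (suc c) f d∣f = ∣m∣n⇒∣m+n (d∣f 0) (∑-∣ c (f ∘ suc) (d∣f ∘ suc))

∑-linear : ∀ c (a b e w : ℕ → ℤ) K →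
  ∑ c (λ i → (a i ℤ.+ b i ℤ.- K ℤ.* e i) ℤ.* w i) ≡
  ∑ c (λ i → a i ℤ.* w i) ℤ.+ ∑ c (λ i → b i ℤ.* w i) ℤ.- K ℤ.* ∑ c (λ i → e i ℤ.* w i)
∑-linear zero    a b e w K = zeros K
  where
  zeros : ∀ K → 0ℤ ≡ 0ℤ ℤ.+ 0ℤ ℤ.- K ℤ.* 0ℤ
  zeros = solve-∀
∑-linear (suc c) a b e w K =
  trans (cong (ℤ._+_ head) (∑-linear c (a ∘ suc) (b ∘ suc) (e ∘ suc) (w ∘ suc) K))
        (step (a 0) (b 0) (e 0) (w 0) (∑′ a) (∑′ b) (∑′ e) K)
  where
  head : ℤ
  head = (a 0 ℤ.+ b 0 ℤ.- K ℤ.* e 0) ℤ.* w 0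
  ∑′ : (ℕ → ℤ) → ℤ
  ∑′ v = ∑ c (λ i → v (suc i) ℤ.* w (suc i))
  step : ∀ a b e w A B E K →
    (a ℤ.+ b ℤ.- K ℤ.* e) ℤ.* w ℤ.+ (A ℤ.+ B ℤ.- K ℤ.* E) ≡
    (a ℤ.* w ℤ.+ A) ℤ.+ (b ℤ.* w ℤ.+ B) ℤ.- K ℤ.* (e ℤ.* w ℤ.+ E)
  step = solve-∀

k∣j⇒i<k⇒0≤i+j⇒0≤j : ∀ {i j k} .{{_ : ℤ.NonNegative k}} →
  k ∣ j → i ℤ.< k → 0ℤ ≤ℤ i ℤ.+ j → 0ℤ ≤ℤ j
k∣j⇒i<k⇒0≤i+j⇒0≤j {i} {_} {k} (divides q refl) i<k 0≤i+j = begin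
  0ℤ        ≡⟨ ℤP.*-zeroˡ k ⟨
  0ℤ ℤ.* k  ≤⟨ ℤP.*-monoʳ-≤-nonNeg k 0≤q ⟩
  q ℤ.* k   ∎
  where
  open ℤP.≤-Reasoning
  0<1+q : 0ℤ ℤ.< ℤ.suc q
  0<1+q = ℤP.*-cancelʳ-<-nonNeg k (begin-strict
    0ℤ ℤ.* k          ≡⟨ ℤP.*-zeroˡ k ⟩
    0ℤ                ≤⟨ 0≤i+j ⟩
    i ℤ.+ q ℤ.* k     <⟨ ℤP.+-monoˡ-< (q ℤ.* k) i<k ⟩
    k ℤ.+ q ℤ.* k     ≡⟨ ℤP.suc-* q k ⟨
    ℤ.suc q ℤ.* k      ∎)
  0≤q : 0ℤ ≤ℤ q
  0≤q = subst (0ℤ ≤ℤ_) (ℤP.pred-suc q) (ℤP.i<j⇒i≤pred[j] 0<1+q)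

n≤o⇒m^n∣m^o : ∀ m {n o} → n ≤ o → m ^ n ℕ.∣ m ^ o
n≤o⇒m^n∣m^o m {n} {o} n≤o = ℕ.divides (m ^ (o ∸ n)) (begin
  m ^ o                ≡⟨ cong (m ^_) (ℕP.m+[n∸m]≡n n≤o) ⟨
  m ^ (n + (o ∸ n))    ≡⟨ ℕP.^-distribˡ-+-* m n (o ∸ n) ⟩
  m ^ n * m ^ (o ∸ n)  ≡⟨ ℕP.*-comm (m ^ n) _ ⟩
  m ^ (o ∸ n) * m ^ n  ∎)
  where open ≡-Reasoning

∑<2^[1+c] : ∀ c f → (∀ i → f i ≤ℤ + (2 ^ suc i)) → ∑ c f ℤ.< + (2 ^ suc c)
∑<2^[1+c] zero    f f≤ = +<+ (s≤s z≤n)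
∑<2^[1+c] (suc c) f f≤ = begin-strict
  ∑ (suc c) f                         ≡⟨ ∑-suc c f ⟩
  ∑ c f ℤ.+ f c                       <⟨ ℤP.+-mono-<-≤ (∑<2^[1+c] c f f≤) (f≤ c) ⟩
  + (2 ^ suc c) ℤ.+ + (2 ^ suc c)     ≡⟨ cong (λ e → + (2 ^ suc c + e)) (ℕP.+-identityʳ _) ⟨
  + (2 ^ suc (suc c))                 ∎
  where open ℤP.≤-Reasoning

digit : ℕ → Bool → Bool → Bool → ℤ
digit k a b c = + bit a ℤ.+ + bit c ℤ.- + k ℤ.* + bit b

bit≤1 : ∀ a → + bit a ≤ℤ + 1
bit≤1 false = +≤+ z≤n
bit≤1 true  = +≤+ (s≤s z≤n)

digit≤2 : ∀ k a b c → digit k a b c ≤ℤ + 2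
digit≤2 k a b c = begin
  + bit a ℤ.+ + bit c ℤ.- + k ℤ.* + bit b  ≡⟨ cong (ℤ._-_ (+ bit a ℤ.+ + bit c)) (ℤP.pos-* k (bit b)) ⟨
  + bit a ℤ.+ + bit c ℤ.- + (k * bit b)    ≤⟨ ℤP.i-j≤i (+ bit a ℤ.+ + bit c) (+ (k * bit b)) ⟩
  + bit a ℤ.+ + bit c                      ≤⟨ ℤP.+-mono-≤ (bit≤1 a) (bit≤1 c) ⟩
  + 2                                      ∎
  where open ℤP.≤-Reasoning

xor≡false⇒2∣bit+bit+bit : ∀ a b c → (a xor b) xor c ≡ false →
  + 2 ∣ + bit a ℤ.+ + bit b ℤ.+ + bit c
xor≡false⇒2∣bit+bit+bit false false false _ = divides 0ℤ refl
xor≡false⇒2∣bit+bit+bit false true  true  _ = divides (+ 1) refl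
xor≡false⇒2∣bit+bit+bit true  false true  _ = divides (+ 1) refl
xor≡false⇒2∣bit+bit+bit true  true  false _ = divides (+ 1) refl
xor≡false⇒2∣bit+bit+bit false false true  ()
xor≡false⇒2∣bit+bit+bit false true  false ()
xor≡false⇒2∣bit+bit+bit true  false false ()
xor≡false⇒2∣bit+bit+bit true  true  true  ()

-- For odd k, x + z − k y ≡ x + y + z modulo 2.
2∣digit : ∀ k a b c → 2 ℕ.∣ suc k → (a xor b) xor c ≡ false → + 2 ∣ digit k a b c
2∣digit k a b c 2∣1+k xor≡false =
  subst (+ 2 ∣_) (sym (regroup (+ bit a) (+ bit b) (+ bit c) (+ k)))
    (∣m∣n⇒∣m-n (xor≡false⇒2∣bit+bit+bit a b c xor≡false) (∣m⇒∣m*n (+ bit b) (∣ᵤ⇒∣ {+ 2} {+ suc k} 2∣1+k)))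
  where
  regroup : ∀ A B C K → A ℤ.+ C ℤ.- K ℤ.* B ≡ A ℤ.+ B ℤ.+ C ℤ.- (+ 1 ℤ.+ K) ℤ.* B
  regroup = solve-∀

val≡∑ : ∀ n (x : ℕ → Bool) → + val n x ≡ ∑ (suc n) (λ i → + bit (x i) ℤ.* + (2 ^ i))
val≡∑ zero    x = sym (trans (ℤP.+-identityʳ _) (ℤP.*-identityʳ _))
val≡∑ (suc n) x = begin
  + val n x ℤ.+ + (bit (x (suc n)) * 2 ^ suc n)  ≡⟨ cong₂ ℤ._+_ (val≡∑ n x) (ℤP.pos-* (bit (x (suc n))) (2 ^ suc n)) ⟩
  ∑ (suc n) w ℤ.+ w (suc n)                      ≡⟨ ∑-suc (suc n) w ⟨
  ∑ (suc (suc n)) w                              ∎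
  where
  open ≡-Reasoning
  w : ℕ → ℤ
  w i = + bit (x i) ℤ.* + (2 ^ i)

module _ (k : ℕ) (x y z : ℕ → Bool) where

  term : ℕ → ℤ
  term i = digit k (x i) (y i) (z i) ℤ.* + (2 ^ i)

  term≤2^[1+i] : ∀ i → term i ≤ℤ + (2 ^ suc i)
  term≤2^[1+i] i = subst (term i ≤ℤ_) (sym (ℤP.pos-* 2 (2 ^ i)))
    (ℤP.*-monoʳ-≤-nonNeg (+ (2 ^ i)) (digit≤2 k (x i) (y i) (z i)))

  2^[1+L]∣term : ∀ {L} → 2 ℕ.∣ suc k → (x L xor y L) xor z L ≡ false →
    ∀ i → L ≤ i → + (2 ^ suc L) ∣ term i
  2^[1+L]∣term {L} 2∣1+k xor≡false i L≤i with ℕP.m≤n⇒m<n∨m≡n L≤i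
  ... | inj₁ L<i  = ∣n⇒∣m*n (digit k (x i) (y i) (z i)) (∣ᵤ⇒∣ (n≤o⇒m^n∣m^o 2 L<i))
  ... | inj₂ refl = subst (_∣ term L) (sym (ℤP.pos-* 2 (2 ^ L)))
    (*-monoˡ-∣ (+ (2 ^ L)) (2∣digit k (x L) (y L) (z L) 2∣1+k xor≡false))

  ∑term≡x+z-ky : ∀ n → ∑ (suc n) term ≡ + val n x ℤ.+ + val n z ℤ.- + k ℤ.* + val n y
  ∑term≡x+z-ky n = trans
    (∑-linear (suc n) (λ i → + bit (x i)) (λ i → + bit (z i)) (λ i → + bit (y i)) (λ i → + (2 ^ i)) (+ k))
    (sym (cong₂ ℤ._-_ (cong₂ ℤ._+_ (val≡∑ n x) (val≡∑ n z)) (cong (ℤ._*_ (+ k)) (val≡∑ n y))))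

  0≤∑term : ∀ n .{{_ : NonZero k}} → val n y ≤ (val n x + val n z) / k → 0ℤ ≤ℤ ∑ (suc n) term
  0≤∑term n y≤[x+z]/k = subst (0ℤ ≤ℤ_) (sym (∑term≡x+z-ky n))
    (ℤP.i≤j⇒0≤j-i (subst (_≤ℤ + (val n x + val n z)) (ℤP.pos-* k (val n y)) (+≤+ ky≤x+z)))
    where
    ky≤x+z : k * val n y ≤ val n x + val n z
    ky≤x+z = ℕP.≤-trans (ℕP.≤-reflexive (ℕP.*-comm k (val n y)))
      (ℕP.≤-trans (ℕP.*-monoˡ-≤ k y≤[x+z]/k) (m/n*n≤m _ k))

lemma2p5 : (m n t : ℕ) → (x y z : ℕ → Bool) → t ≤ n →
    (∀ i → i ≤ n ∸ t → (x i xor y i) xor z i ≡ false) →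
    val n y ≤ (val n x + val n z) / (3 + 4 * m) →
    + 0 ≤ℤ S (3 + 4 * m) n t x y z
lemma2p5 m n t x y z _ xor≡false y≤[x+z]/k =
  subst (0ℤ ≤ℤ_) (sym (sumRangeℤ≡∑ L n T))
    (k∣j⇒i<k⇒0≤i+j⇒0≤j 2^[1+L]∣high (∑<2^[1+c] L T (term≤2^[1+i] k x y z)) 0≤low+high)
  where
  k L : ℕ
  k = 3 + 4 * m
  L = n ∸ t
  T : ℕ → ℤ
  T = term k x y z
  k-odd : 2 ℕ.∣ suc k
  k-odd = ℕ.∣m∣n⇒∣m+n (ℕ.divides 2 refl) (ℕ.∣m⇒∣m*n m (ℕ.divides 2 refl))
  2^[1+L]∣high : + (2 ^ suc L) ∣ ∑ (suc n ∸ L) (λ j → T (L + j))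
  2^[1+L]∣high = ∑-∣ (suc n ∸ L) (λ j → T (L + j))
    (λ j → 2^[1+L]∣term k x y z k-odd (xor≡false L ℕP.≤-refl) (L + j) (ℕP.m≤m+n L j))
  0≤low+high : 0ℤ ≤ℤ ∑ L T ℤ.+ ∑ (suc n ∸ L) (λ j → T (L + j))
  0≤low+high = subst (0ℤ ≤ℤ_)
    (trans (cong (λ c → ∑ c T) (sym (ℕP.m+[n∸m]≡n (ℕP.≤-trans (ℕP.m∸n≤m n t) (ℕP.n≤1+n n)))))
           (∑-+ L (suc n ∸ L) T))
    (0≤∑term k x y z n y≤[x+z]/k)
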